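{- Let $\alpha$ be a positive rational number and let $0<n\le N$. Let $\mathbf A$ be a factorization of $\alpha_n$ and $\mathbf B$ a factorization of $\alpha_{n-1}$. If $\mathbf B$ is a direct subfactorization of $\mathbf A$ and $\mathbf A$ is primitive, then $\mathbf B$ is primitive and $\mathbf A\in\Delta(\mathbf B)$.
   Context: Write $\alpha=a/b$ with $a,b$ coprime positive integers. Let $p_1\ge\cdots\ge p_N$ be the primes dividing $ab$, listed with multiplicity. Put $\gamma(i)=1$ if $p_i\mid a$, $\gamma(i)=-1$ if $p_i\mid b$, and $\alpha_n=\prod_{i=1}^n p_i^{\gamma(i)}$ for $0\le n\le N$. A factorization of a positive rational $\beta$ is a sequence $(a_1/b_1,a_2/b_2,\dots)$ with $a_i,b_i$ positive integers, $a_i=b_i=1$ for all but finitely many $i$, $\prod_i a_i/b_i=\beta$, $\max\{a_i,b_i\}\ge\max\{a_{i+1},b_{i+1}\}$ for all $i$, and $\gcd(a_i,b_j)=1$ for all $i,j$; it is primitive if each $\max\{a_i,b_i\}$ is prime or $1$. For $0\le n<N$, a factorization $(a_i/b_i)$ of $\alpha_n$ is a direct subfactorization of a factorization $(c_i/d_i)$ of $\alpha_{n+1}$ if either $p_{n+1}\mid a$ and for some $k$: $d_i=b_i$ for all $i$, $c_i=a_i$ for $i\ne k$, $c_k=a_kp_{n+1}$; or $p_{n+1}\mid b$ and for some $k$: $c_i=a_i$ for all $i$, $d_i=b_i$ for $i\ne k$, $d_k=b_kp_{n+1}$. For $0\le n<N$ and a factorization $\mathbf C=(a_1/b_1,\dots,a_\ell/b_\ell,1,1,\dots)$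 of $\alpha_n$ with $a_\ell/b_\ell\ne1$ ($\ell=0$ if $\mathbf C=(1,1,\dots)$): if $p_{n+1}\mid a$, $\delta(\mathbf C)$ is the set of sequences obtained from $\mathbf C$ by replacing $a_k/b_k$ by $a_kp_{n+1}/b_k$ for some $k$ with $a_kp_{n+1}<b_k$, and $\epsilon(\mathbf C)=\{(a_1/b_1,\dots,a_\ell/b_\ell,p_{n+1}/1,1,\dots)\}$; if $p_{n+1}\mid b$, $\delta(\mathbf C)$ consists of sequences obtained by replacing $a_k/b_k$ by $a_k/(b_kp_{n+1})$ for some $k$ with $b_kp_{n+1}<a_k$, and $\epsilon(\mathbf C)=\{(a_1/b_1,\dots,a_\ell/b_\ell,1/p_{n+1},1,\dots)\}$. $\Delta(\mathbf C)=\delta(\mathbf C)\cup\epsilon(\mathbf C)$. -}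

module Defs where

open import Data.Nat using (ℕ; zero; suc; _+_; _*_; _∸_; _≤_; _<_; _⊔_)
open import Data.Nat.Divisibility using (_∣_; _∣?_)
open import Data.Nat.Coprimality using (Coprime)
open import Data.Nat.Primality using (Prime)
open import Data.Product using (Σ; _×_; _,_; proj₁; proj₂)
open import Data.Sum using (_⊎_)
open import Data.Unit using (⊤)
open import Relation.Nullary using (¬_; yes; no)
open import Relation.Binary.PropositionalEquality using (_≡_; _≢_)

prod0 : ℕ → (ℕ → ℕ) → ℕ
prod0 zero    f = 1
prod0 (suc L) f = prod0 L f * f L

prod1 : ℕ → (ℕ → ℕ) → ℕ
prod1 n f = prod0 n (λ i → f (suc i))

-- The primes p_1 ≥ ... ≥ p_N dividing a*b, listed with multiplicity
-- (p is 1-indexed; its values outside 1..N are irrelevant).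
IsPrimeList : ℕ → ℕ → ℕ → (ℕ → ℕ) → Set
IsPrimeList a b N p =
  (∀ i → 1 ≤ i → i ≤ N → Prime (p i)) ×
  (∀ i → 1 ≤ i → i < N → p (suc i) ≤ p i) ×
  (prod1 N p ≡ a * b)

-- numerator and denominator of α_n = ∏_{i ≤ n} p_i^{γ(i)}
αnum : ℕ → (ℕ → ℕ) → ℕ → ℕ
αnum a p n = prod1 n (λ i → f i (p i ∣? a))
  where
  f : ∀ i → _ → ℕ
  f i (yes _) = p i
  f i (no _)  = 1

αden : ℕ → (ℕ → ℕ) → ℕ → ℕ
αden b p n = prod1 n (λ i → f i (p i ∣? b))
  where
  f : ∀ i → _ → ℕ
  f i (yes _) = p i
  f i (no _)  = 1

-- A sequence (a_i/b_i) of pairs of naturals, 0-indexed: C i = (a_{i+1} , b_{i+1}).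
Seq : Set
Seq = ℕ → ℕ × ℕ

num : Seq → ℕ → ℕ
num C i = proj₁ (C i)

den : Seq → ℕ → ℕ
den C i = proj₂ (C i)

mx : Seq → ℕ → ℕ
mx C i = num C i ⊔ den C i

IsFactorization : ℕ → ℕ → Seq → Set
IsFactorization A B C =
  (∀ i → 1 ≤ num C i) × (∀ i → 1 ≤ den C i) ×
  Σ ℕ (λ L → (∀ i → L ≤ i → C i ≡ (1 , 1)) ×
             (prod0 L (num C) * B ≡ prod0 L (den C) * A)) ×
  (∀ i → mx C (suc i) ≤ mx C i) ×
  (∀ i j → Coprime (num C i) (den C j))

Primitive : Seq → Set
Primitive C = ∀ i → Prime (mx C i) ⊎ mx C i ≡ 1

-- Ba is a direct subfactorization of Cc, where Ba factors α_n, Cc factors α_{n+1}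
DirectSub : ℕ → ℕ → (ℕ → ℕ) → ℕ → Seq → Seq → Set
DirectSub a b p n Ba Cc =
  (p (suc n) ∣ a × Σ ℕ (λ k →
      (∀ i → den Cc i ≡ den Ba i) ×
      (∀ i → i ≢ k → num Cc i ≡ num Ba i) ×
      num Cc k ≡ num Ba k * p (suc n)))
  ⊎
  (p (suc n) ∣ b × Σ ℕ (λ k →
      (∀ i → num Cc i ≡ num Ba i) ×
      (∀ i → i ≢ k → den Cc i ≡ den Ba i) ×
      den Cc k ≡ den Ba k * p (suc n)))

-- ℓ is the length of C = (a_1/b_1, …, a_ℓ/b_ℓ, 1, 1, …) with a_ℓ/b_ℓ ≠ 1
-- (0-indexed: entries with index ≥ ℓ are 1, and entry ℓ-1 is not 1)
IsLength : Seq → ℕ → Set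
IsLength C ℓ = (∀ i → ℓ ≤ i → C i ≡ (1 , 1)) × LastNontrivial ℓ
  where
  LastNontrivial : ℕ → Set
  LastNontrivial zero    = ⊤
  LastNontrivial (suc m) = num C m ≢ den C m

-- membership of D in δ(C) and ε(C), for the case p_{n+1} ∣ a
δa : ℕ → Seq → Seq → Set
δa q C D = Σ ℕ λ k → (num C k * q < den C k) ×
  (D k ≡ (num C k * q , den C k)) × (∀ i → i ≢ k → D i ≡ C i)

εa : ℕ → Seq → Seq → Set
εa q C D = Σ ℕ λ ℓ → IsLength C ℓ ×
  (D ℓ ≡ (q , 1)) × (∀ i → i ≢ ℓ → D i ≡ C i)

-- … and for the case p_{n+1} ∣ b
δb : ℕ → Seq → Seq → Set
δb q C D = Σ ℕ λ k → (den C k * q < num C k) ×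
  (D k ≡ (num C k , den C k * q)) × (∀ i → i ≢ k → D i ≡ C i)

εb : ℕ → Seq → Seq → Set
εb q C D = Σ ℕ λ ℓ → IsLength C ℓ ×
  (D ℓ ≡ (1 , q)) × (∀ i → i ≢ ℓ → D i ≡ C i)

InΔ : ℕ → ℕ → (ℕ → ℕ) → ℕ → Seq → Seq → Set
InΔ a b p n C D =
  (p (suc n) ∣ a → δa (p (suc n)) C D ⊎ εa (p (suc n)) C D) ×
  (p (suc n) ∣ b → δb (p (suc n)) C D ⊎ εb (p (suc n)) C D)

module Submission where

open import Defs
open import Data.Nat using (ℕ; _∸_; _≤_; _<_; _*_)
open import Data.Nat.Coprimality using (Coprime)
open import Data.Product using (_×_)

open import Data.Nat using (zero; suc; _⊔_; z≤n; s≤s; _<?_; _≟_; >-nonZero; nonTrivial⇒n>1)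
open import Data.Nat.Properties
open import Data.Nat.Divisibility
open import Data.Nat.Primality
open import Data.Nat.Primality.Factorisation using (factorise)
import Data.Nat.Coprimality as Coprimality
open import Data.Nat.ListAction using (product)
open import Data.List using ([]; _∷_)
open import Data.List.Relation.Unary.All using (_∷_)
open import Data.Product using (Σ; _,_; proj₁; proj₂; map₂)
open import Data.Sum using (_⊎_; inj₁; inj₂)
open import Data.Empty using (⊥; ⊥-elim)
open import Data.Unit using (tt)
open import Relation.Nullary using (yes; no)
open import Relation.Binary.PropositionalEquality

-- Proof of Lemma 3.4.  Write q = p_{n}.  Since a and b are coprime, q divides
-- exactly one of them; the case q ∣ b is the case q ∣ a for the swapped
-- sequences a_i/b_i ↦ b_i/a_i, so suppose q ∣ a and A arises from B by
-- replacing a_k/b_k with a_k q/b_k.  Every other entry is unchanged.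
--   * If a_k q < b_k, the k-th maxima of A and B agree, so B is primitive and
--     A ∈ δ(B).
--   * Otherwise max(A_k) = a_k q is prime, so a_k = 1 and b_k ≤ q.  Every prime
--     dividing b_k divides the denominator of α_{n-1}, whose primes are among
--     p_1 ≥ … ≥ p_{n-1}, hence are ≥ q; together with gcd(q, b_k) = 1 this
--     forces b_k = 1.  So B_k = 1, all later entries of B are 1 (the maxima
--     decrease), and B_{k-1} ≠ 1 (max(A_{k-1}) ≥ q), i.e. B has length k and
--     A ∈ ε(B).

prime≥2 : ∀ {r} → Prime r → 2 ≤ r
prime≥2 {r} r-prime = nonTrivial⇒n>1 r {{prime⇒nonTrivial r-prime}}

primeDivisor : ∀ d → 2 ≤ d → Σ ℕ λ r → Prime r × r ∣ d
primeDivisor d 2≤d with factorise d {{>-nonZero (≤-trans (s≤s z≤n) 2≤d)}}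
... | record { factors = [] ; isFactorisation = d≡1 } = ⊥-elim (<⇒≢ 2≤d (sym d≡1))
... | record { factors = r ∷ rs ; isFactorisation = d≡r*rs ; factorsPrime = r-prime ∷ _ } =
  r , r-prime , subst (r ∣_) (sym d≡r*rs) (m∣m*n (product rs))

prime∣prod0 : ∀ {r} → Prime r → ∀ L (f : ℕ → ℕ) → r ∣ prod0 L f → Σ ℕ λ i → i < L × r ∣ f i
prime∣prod0 r-prime zero    f r∣1 = ⊥-elim (¬prime[1] (subst Prime (∣1⇒≡1 r∣1) r-prime))
prime∣prod0 r-prime (suc L) f r∣prod with euclidsLemma (prod0 L f) (f L) r-prime r∣prod
... | inj₂ r∣fL = L , n<1+n L , r∣fL
... | inj₁ r∣prodL with prime∣prod0 r-prime L f r∣prodL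
...   | i , i<L , r∣fi = i , m<n⇒m<1+n i<L , r∣fi

factor∣prod0 : ∀ L (f : ℕ → ℕ) k → k < L → f k ∣ prod0 L f
factor∣prod0 (suc L) f k k<1+L with m<1+n⇒m<n∨m≡n k<1+L
... | inj₁ k<L  = ∣m⇒∣m*n (f L) (factor∣prod0 L f k k<L)
... | inj₂ refl = n∣m*n (prod0 L f)

antitone : ∀ {lo hi} (f : ℕ → ℕ) → (∀ i → lo ≤ i → i < hi → f (suc i) ≤ f i) →
  ∀ {i j} → lo ≤ i → i ≤ j → j ≤ hi → f j ≤ f i
antitone f step {i = i} {j} lo≤i i≤j j≤hi with m≤n⇒m<n∨m≡n i≤j
... | inj₂ refl = ≤-refl
antitone f step {i = i} {suc j} lo≤i _ j<hi | inj₁ (s≤s i≤j) =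
  ≤-trans (step j (≤-trans lo≤i i≤j) j<hi)
          (antitone f step lo≤i i≤j (≤-trans (n≤1+n j) j<hi))

IsPartialProduct : (ℕ → ℕ) → (ℕ → ℕ) → Set
IsPartialProduct p α =
  α 0 ≡ 1 × (∀ m → α (suc m) ≡ α m * p (suc m) ⊎ α (suc m) ≡ α m)

αnum-partial : ∀ a p → IsPartialProduct p (αnum a p)
αnum-partial a p = refl , step
  where
  step : ∀ m → αnum a p (suc m) ≡ αnum a p m * p (suc m) ⊎ αnum a p (suc m) ≡ αnum a p m
  step m with p (suc m) ∣? a
  ... | yes _ = inj₁ refl
  ... | no _  = inj₂ (*-identityʳ _)

αden-partial : ∀ b p → IsPartialProduct p (αden b p)
αden-partial b p = refl , step
  where
  step : ∀ m → αden b p (suc m) ≡ αden b p m * p (suc m) ⊎ αden b p (suc m) ≡ αden b p m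
  step m with p (suc m) ∣? b
  ... | yes _ = inj₁ refl
  ... | no _  = inj₂ (*-identityʳ _)

prime∣partial : ∀ {p α} → IsPartialProduct p α → ∀ {r} → Prime r →
  ∀ m → r ∣ α m → Σ ℕ λ i → 1 ≤ i × i ≤ m × r ∣ p i
prime∣partial (α0≡1 , _) r-prime zero r∣α0 =
  ⊥-elim (¬prime[1] (subst Prime (∣1⇒≡1 (subst (_ ∣_) α0≡1 r∣α0)) r-prime))
prime∣partial {p} {α} pp@(_ , step) {r} r-prime (suc m) r∣α with earlier-or-last
  where
  earlier-or-last : r ∣ α m ⊎ r ∣ p (suc m)
  earlier-or-last with step m
  ... | inj₁ times = euclidsLemma (α m) (p (suc m)) r-prime (subst (r ∣_) times r∣α)
  ... | inj₂ same  = inj₁ (subst (r ∣_) same r∣α)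
... | inj₂ r∣p = suc m , s≤s z≤n , ≤-refl , r∣p
... | inj₁ r∣αm with prime∣partial pp r-prime m r∣αm
...   | i , 1≤i , i≤m , r∣pi = i , 1≤i , m≤n⇒m≤1+n i≤m , r∣pi

partial-primes≥ : ∀ {N p α} →
  (∀ i → 1 ≤ i → i ≤ N → Prime (p i)) → (∀ i → 1 ≤ i → i < N → p (suc i) ≤ p i) →
  IsPartialProduct p α → ∀ m → suc m ≤ N → ∀ r → Prime r → r ∣ α m → p (suc m) ≤ r
partial-primes≥ {p = p} p-prime p-dec pp m m<N r r-prime r∣α
  with prime∣partial pp r-prime m r∣α
... | i , 1≤i , i≤m , r∣pi
  with prime⇒irreducible (p-prime i 1≤i (≤-trans (m≤n⇒m≤1+n i≤m) m<N)) r∣pi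
...   | inj₁ r≡1  = ⊥-elim (¬prime[1] (subst Prime r≡1 r-prime))
...   | inj₂ refl = antitone p p-dec 1≤i (m≤n⇒m≤1+n i≤m) m<N

-- Every prime dividing some denominator b_k of a factorization of X/Y
-- divides Y: it is coprime to all numerators, and ∏ a_i · Y = ∏ b_i · X.
prime∣den⇒∣Y : ∀ {X Y C} → IsFactorization X Y C → ∀ {r} → Prime r →
  ∀ k → r ∣ den C k → r ∣ Y
prime∣den⇒∣Y {X} {Y} {C} (_ , _ , (L , C-tail , C-prod) , _ , C-coprime) {r} r-prime k r∣dk
  with k <? L
... | no k≮L = ⊥-elim (¬prime[1] (subst Prime
        (∣1⇒≡1 (subst (r ∣_) (cong proj₂ (C-tail k (≮⇒≥ k≮L))) r∣dk)) r-prime))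
... | yes k<L with euclidsLemma (prod0 L (num C)) Y r-prime r∣numsY
  where
  r∣numsY : r ∣ prod0 L (num C) * Y
  r∣numsY = subst (r ∣_) (sym C-prod)
              (∣m⇒∣m*n X (∣-trans r∣dk (factor∣prod0 L (den C) k k<L)))
...   | inj₂ r∣Y = r∣Y
...   | inj₁ r∣nums with prime∣prod0 r-prime L (num C) r∣nums
...     | i , _ , r∣ai = ⊥-elim (¬prime[1] (subst Prime (C-coprime i k (r∣ai , r∣dk)) r-prime))

mx≤1⇒trivial : ∀ C i → 1 ≤ num C i → 1 ≤ den C i → mx C i ≤ 1 → C i ≡ (1 , 1)
mx≤1⇒trivial C i 1≤a 1≤b mx≤1 =
  cong₂ _,_ (≤-antisym (≤-trans (m≤m⊔n (num C i) (den C i)) mx≤1) 1≤a)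
            (≤-antisym (≤-trans (m≤n⊔m (num C i) (den C i)) mx≤1) 1≤b)

isLength : ∀ C ℓ → (∀ i → ℓ ≤ i → C i ≡ (1 , 1)) →
  (∀ m → suc m ≡ ℓ → num C m ≢ den C m) → IsLength C ℓ
isLength C zero    tail _    = tail , tt
isLength C (suc m) tail last = tail , last m refl

-- A arises from B by replacing the k-th entry a_k/b_k by a_k q/b_k.  Under the
-- swap, the other kind of direct subfactorization is of this form as well.
MultipliesNumerator : ℕ → ℕ → Seq → Seq → Set
MultipliesNumerator q k B A =
  (∀ i → den A i ≡ den B i) × (∀ i → i ≢ k → num A i ≡ num B i) × num A k ≡ num B k * q

-- The case q ∣ a of the lemma, for an arbitrary factorization B of X/Y whose
-- denominator Y has only prime factors ≥ q, and an arbitrary factorization A.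
module MultiplyNumerator {q k X Y X′ Y′ : ℕ} {A B : Seq}
  (q-prime : Prime q)
  (step : MultipliesNumerator q k B A)
  (B-fact : IsFactorization X Y B)
  (A-fact : IsFactorization X′ Y′ A)
  (Y-primes≥q : ∀ r → Prime r → r ∣ Y → q ≤ r)
  (A-prim : Primitive A) where

  same-den : ∀ i → den A i ≡ den B i
  same-den = proj₁ step
  same-num : ∀ i → i ≢ k → num A i ≡ num B i
  same-num = proj₁ (proj₂ step)
  num-k : num A k ≡ num B k * q
  num-k = proj₂ (proj₂ step)

  B-num≥1 : ∀ i → 1 ≤ num B i
  B-num≥1 = proj₁ B-fact
  B-den≥1 : ∀ i → 1 ≤ den B i
  B-den≥1 = proj₁ (proj₂ B-fact)
  B-dec : ∀ i → mx B (suc i) ≤ mx B i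
  B-dec = proj₁ (proj₂ (proj₂ (proj₂ B-fact)))
  A-dec : ∀ i → mx A (suc i) ≤ mx A i
  A-dec = proj₁ (proj₂ (proj₂ (proj₂ A-fact)))
  A-coprime : ∀ i j → Coprime (num A i) (den A j)
  A-coprime = proj₂ (proj₂ (proj₂ (proj₂ A-fact)))

  x : ℕ
  x = num B k
  d : ℕ
  d = den B k

  unchanged : ∀ i → i ≢ k → A i ≡ B i
  unchanged i i≢k = cong₂ _,_ (same-num i i≢k) (same-den i)

  B-primitive : mx B k ≡ mx A k ⊎ mx B k ≡ 1 → Primitive B
  B-primitive _ i with i ≟ k
  ... | no i≢k =
    subst (λ v → Prime v ⊎ v ≡ 1) (cong (λ z → proj₁ z ⊔ proj₂ z) (unchanged i i≢k)) (A-prim i)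
  B-primitive (inj₁ same) i | yes refl = subst (λ v → Prime v ⊎ v ≡ 1) (sym same) (A-prim k)
  B-primitive (inj₂ one)  i | yes refl = inj₂ one

  -- If x q < d, the k-th maximum is d in both, so A ∈ δ(B).
  δ-case : x * q < d → Primitive B × δa q B A
  δ-case xq<d = B-primitive (inj₁ (trans mxB≡d (sym mxA≡d))) ,
                (k , xq<d , cong₂ _,_ num-k (same-den k) , unchanged)
    where
    mxB≡d : mx B k ≡ d
    mxB≡d = m≤n⇒m⊔n≡n (≤-trans (m≤m*n x q {{prime⇒nonZero q-prime}}) (<⇒≤ xq<d))
    mxA≡d : mx A k ≡ d
    mxA≡d = trans (cong₂ _⊔_ num-k (same-den k)) (m≤n⇒m⊔n≡n (<⇒≤ xq<d))

  -- Otherwise A_k = q/1 and B_k = 1, and B has length k: A ∈ ε(B).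
  module ε-case (d≤xq : d ≤ x * q) where

    mxA≡xq : mx A k ≡ x * q
    mxA≡xq = trans (cong₂ _⊔_ num-k (same-den k)) (m≥n⇒m⊔n≡m d≤xq)

    q≤mxA : q ≤ mx A k
    q≤mxA = subst (q ≤_) (sym mxA≡xq) (m≤n*m q x {{>-nonZero (B-num≥1 k)}})

    -- x q = max(A_k) is prime (it is ≥ q ≥ 2), so its proper factor x is 1.
    x≡1 : x ≡ 1
    x≡1 with A-prim k
    ... | inj₂ mx≡1  = ⊥-elim (<⇒≱ (prime≥2 q-prime) (subst (q ≤_) mx≡1 q≤mxA))
    ... | inj₁ mx-prime with prime⇒irreducible (subst Prime mxA≡xq mx-prime) (m∣m*n {x} q)
    ...   | inj₁ x≡1   = x≡1
    ...   | inj₂ x≡xq = ⊥-elim (<⇒≢ (prime≥2 q-prime)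
              (*-cancelˡ-≡ 1 q x {{>-nonZero (B-num≥1 k)}} (trans (*-identityʳ x) x≡xq)))

    num-Ak : num A k ≡ q
    num-Ak = trans num-k (trans (cong (_* q) x≡1) (*-identityˡ q))

    -- A prime factor r of d is ≥ q (it divides Y) and ≤ d ≤ q, so r = q
    -- divides both num A k = q and den A k = d, contradicting coprimality.
    d≡1 : d ≡ 1
    d≡1 with m≤n⇒m<n∨m≡n (B-den≥1 k)
    ... | inj₂ 1≡d = sym 1≡d
    ... | inj₁ 2≤d with primeDivisor d 2≤d
    ...   | r , r-prime , r∣d =
      ⊥-elim (¬prime[1] (subst Prime (A-coprime k k (r∣numAk , r∣denAk)) r-prime))
      where
      d≤q : d ≤ q
      d≤q = subst (d ≤_) num-Ak (subst (d ≤_) (sym num-k) d≤xq)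
      r≤q : r ≤ q
      r≤q = ≤-trans (∣⇒≤ {{>-nonZero (B-den≥1 k)}} r∣d) d≤q
      r≡q : r ≡ q
      r≡q = ≤-antisym r≤q (Y-primes≥q r r-prime (prime∣den⇒∣Y B-fact r-prime k r∣d))
      r∣numAk : r ∣ num A k
      r∣numAk = subst (r ∣_) (sym num-Ak) (∣-reflexive r≡q)
      r∣denAk : r ∣ den A k
      r∣denAk = subst (r ∣_) (sym (same-den k)) r∣d

    A-k : A k ≡ (q , 1)
    A-k = cong₂ _,_ num-Ak (trans (same-den k) d≡1)

    -- Since max(B_k) = 1 and the maxima decrease, B is trivial from k on.
    tail : ∀ i → k ≤ i → B i ≡ (1 , 1)
    tail i k≤i = mx≤1⇒trivial B i (B-num≥1 i) (B-den≥1 i)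
      (≤-trans (antitone (mx B) (λ j _ _ → B-dec j) z≤n k≤i ≤-refl)
               (≤-reflexive (cong₂ _⊔_ x≡1 d≡1)))

    -- B_{k-1} = A_{k-1} is not 1: a_{k-1} = b_{k-1} forces both to be 1 by
    -- coprimality, while max(A_{k-1}) ≥ max(A_k) ≥ q ≥ 2.
    last : ∀ m → suc m ≡ k → num B m ≢ den B m
    last m 1+m≡k num≡den =
      <⇒≱ (prime≥2 q-prime) (≤-trans q≤mxA (≤-trans mxA≤mxAm (≤-reflexive mxAm≡1)))
      where
      m≢k : m ≢ k
      m≢k m≡k = 1+n≢n (trans 1+m≡k (sym m≡k))
      eq : num A m ≡ den A m
      eq = trans (same-num m m≢k) (trans num≡den (sym (same-den m)))
      numAm≡1 : num A m ≡ 1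
      numAm≡1 = A-coprime m m (∣-refl , ∣-reflexive eq)
      mxAm≡1 : mx A m ≡ 1
      mxAm≡1 = cong₂ _⊔_ numAm≡1 (trans (sym eq) numAm≡1)
      mxA≤mxAm : mx A k ≤ mx A m
      mxA≤mxAm = subst (λ j → mx A j ≤ mx A m) 1+m≡k (A-dec m)

    result : Primitive B × εa q B A
    result = B-primitive (inj₂ (cong₂ _⊔_ x≡1 d≡1)) ,
             (k , isLength B k tail last , A-k , unchanged)

  result : Primitive B × (δa q B A ⊎ εa q B A)
  result with x * q <? d
  ... | yes xq<d = map₂ inj₁ (δ-case xq<d)
  ... | no  xq≮d = map₂ inj₂ (ε-case.result (≮⇒≥ xq≮d))

-- Exchanging numerators and denominators turns a factorization of X/Y into
-- one of Y/X and reduces the case q ∣ b to the case q ∣ a.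
swapPair : ℕ × ℕ → ℕ × ℕ
swapPair (u , v) = (v , u)

swap : Seq → Seq
swap C i = swapPair (C i)

swap-factorization : ∀ {X Y C} → IsFactorization X Y C → IsFactorization Y X (swap C)
swap-factorization {C = C} (num≥1 , den≥1 , (L , tail , prod) , dec , coprime) =
  den≥1 , num≥1 , (L , (λ i L≤i → cong swapPair (tail i L≤i)) , sym prod) ,
  (λ i → subst₂ _≤_ (⊔-comm (num C (suc i)) (den C (suc i))) (⊔-comm (num C i) (den C i)) (dec i)) ,
  (λ i j → Coprimality.sym (coprime j i))

swap-primitive : ∀ C → Primitive C → Primitive (swap C)
swap-primitive C prim i = subst (λ v → Prime v ⊎ v ≡ 1) (⊔-comm (num C i) (den C i)) (prim i)

swap-isLength : ∀ C ℓ → IsLength (swap C) ℓ → IsLength C ℓ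
swap-isLength C zero    (tail , _) = (λ i 0≤i → cong swapPair (tail i 0≤i)) , tt
swap-isLength C (suc m) (tail , den≢num) =
  (λ i ℓ≤i → cong swapPair (tail i ℓ≤i)) , λ num≡den → den≢num (sym num≡den)

swap-Δ : ∀ q A B → δa q (swap B) (swap A) ⊎ εa q (swap B) (swap A) → δb q B A ⊎ εb q B A
swap-Δ q A B (inj₁ (k , lt , A-k , unchanged)) =
  inj₁ (k , lt , cong swapPair A-k , λ i i≢k → cong swapPair (unchanged i i≢k))
swap-Δ q A B (inj₂ (ℓ , length , A-ℓ , unchanged)) =
  inj₂ (ℓ , swap-isLength B ℓ length , cong swapPair A-ℓ , λ i i≢ℓ → cong swapPair (unchanged i i≢ℓ))

-- Lemma 3.4.  With q = p_n: the denominator (resp. numerator) of α_{n-1} has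
-- only prime factors among p_1 ≥ … ≥ p_{n-1}, all ≥ q; apply MultiplyNumerator
-- directly if q ∣ a and to the swapped sequences if q ∣ b.
lemma3p4 : (a b : ℕ) → 1 ≤ a → 1 ≤ b → Coprime a b →
    (N : ℕ) (p : ℕ → ℕ) → IsPrimeList a b N p →
    (n : ℕ) → 0 < n → n ≤ N →
    (A B : Seq) →
    IsFactorization (αnum a p n) (αden b p n) A →
    IsFactorization (αnum a p (n ∸ 1)) (αden b p (n ∸ 1)) B →
    DirectSub a b p (n ∸ 1) B A →
    Primitive A →
    Primitive B × InΔ a b p (n ∸ 1) B A
lemma3p4 a b _ _ a⊥b N p (p-prime , p-dec , _) (suc n) _ n<N A B A-fact B-fact direct A-prim =
  by-case direct
  where
  q-prime : Prime (p (suc n))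
  q-prime = p-prime (suc n) (s≤s z≤n) n<N
  not-both : p (suc n) ∣ a → p (suc n) ∣ b → ⊥
  not-both q∣a q∣b = ¬prime[1] (subst Prime (a⊥b (q∣a , q∣b)) q-prime)
  by-case : DirectSub a b p n B A → Primitive B × InΔ a b p n B A
  by-case (inj₁ (q∣a , k , step)) with MultiplyNumerator.result {k = k} q-prime step B-fact A-fact
      (partial-primes≥ p-prime p-dec (αden-partial b p) n n<N) A-prim
  ... | B-prim , Δ = B-prim , (λ _ → Δ) , (λ q∣b → ⊥-elim (not-both q∣a q∣b))
  by-case (inj₂ (q∣b , k , step)) with MultiplyNumerator.result {k = k} q-prime step
      (swap-factorization B-fact) (swap-factorization A-fact)
      (partial-primes≥ p-prime p-dec (αnum-partial a p) n n<N) (swap-primitive A A-prim)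
  -- swap (swap B) is B up to η, so B-prim yields primitivity of B
  ... | B-prim , Δ = swap-primitive (swap B) B-prim ,
                     (λ q∣a → ⊥-elim (not-both q∣a q∣b)) , (λ _ → swap-Δ _ A B Δ)
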